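{- For any graph $G$ of order $n$, $\mathrm{H}(G)=n$ if and only if $G\cong K_n$.
   Context: All graphs are finite, simple and undirected; $N(v)$ is the open neighborhood of $v$. Vertices are colored blue or white. Under the hopping color change rule, a blue vertex $v$ may force a white vertex $w$ (not necessarily adjacent to $v$) to become blue provided $v$ has not previously performed a force and every vertex of $N(v)$ is blue. Starting from an initial blue set $B\subseteq V(G)$, forces are applied one at a time until no further force is possible. $B$ is a hopping forcing set of $G$ if some such sequence of forces turns every vertex blue. The hopping forcing number $\mathrm{H}(G)$ is the minimum size of a hopping forcing set of $G$. -}

module Defs where

open import Data.Nat using (ℕ; _≤_)
open import Data.Bool using (Bool; true; false)
open import Data.Fin using (Fin)
open import Data.Fin.Subset using (Subset; _∈_; _∉_; ⁅_⁆; _∪_; ∣_∣; ⊤) renaming (⊥ to ∅)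
open import Data.Product using (Σ; ∃; _×_; _,_)
open import Relation.Binary.PropositionalEquality using (_≡_; _≢_)
open import Relation.Binary.Construct.Closure.ReflexiveTransitive using (Star)
open import Relation.Nullary using (¬_)
open import Function.Bundles using (_⤖_; Bijection)

record Graph (n : ℕ) : Set where
  field
    adj   : Fin n → Fin n → Bool
    adj-sym : ∀ u v → adj u v ≡ adj v u
    adj-irrefl : ∀ v → adj v v ≡ false
open Graph public

complete : (n : ℕ) → Graph n
complete n = record
  { adj = λ u v → isDiff u v
  ; adj-sym = λ u v → isDiff-sym u v
  ; adj-irrefl = isDiff-refl }
  where
  open import Data.Fin.Properties using (_≟_)
  open import Relation.Nullary using (yes; no)
  open import Relation.Binary.PropositionalEquality using (refl; sym)
  isDiff : Fin n → Fin n → Bool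
  isDiff u v with u ≟ v
  ... | yes _ = false
  ... | no _ = true
  isDiff-refl : ∀ v → isDiff v v ≡ false
  isDiff-refl v with v ≟ v
  ... | yes _ = refl
  ... | no v≢v = Data.Empty.⊥-elim (v≢v refl)
    where import Data.Empty
  isDiff-sym : ∀ u v → isDiff u v ≡ isDiff v u
  isDiff-sym u v with u ≟ v | v ≟ u
  ... | yes _ | yes _ = refl
  ... | no _ | no _ = refl
  ... | yes p | no q = Data.Empty.⊥-elim (q (sym p))
    where import Data.Empty
  ... | no p | yes q = Data.Empty.⊥-elim (p (sym q))
    where import Data.Empty

_≅_ : ∀ {n m} → Graph n → Graph m → Set
_≅_ {n} {m} G H =
  Σ (Fin n ⤖ Fin m) λ f →
    ∀ u v → adj G u v ≡ adj H (Bijection.to f u) (Bijection.to f v)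

-- State of the hopping forcing process: (blue set, set of vertices that have already forced).
State : ℕ → Set
State n = Subset n × Subset n

data HopStep {n : ℕ} (G : Graph n) : State n → State n → Set where
  force : ∀ {B U : Subset n} (v w : Fin n) →
          v ∈ B →
          v ∉ U →
          w ∉ B →
          (∀ u → adj G v u ≡ true → u ∈ B) →
          HopStep G (B , U) (⁅ w ⁆ ∪ B , ⁅ v ⁆ ∪ U)

IsHoppingForcingSet : ∀ {n} → Graph n → Subset n → Set
IsHoppingForcingSet {n} G B =
  ∃ λ (U : Subset n) → ∃ λ (B' : Subset n) →
    Star (HopStep G) (B , ∅) (B' , U) × (∀ x → x ∈ B')

HoppingForcingNumber : ∀ {n} → Graph n → ℕ → Set
HoppingForcingNumber {n} G k =
  (∃ λ (B : Subset n) → IsHoppingForcingSet G B × ∣ B ∣ ≡ k) ×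
  (∀ (B : Subset n) → IsHoppingForcingSet G B → k ≤ ∣ B ∣)

{-# OPTIONS --safe #-}
-- In K_n no vertex can ever force: a blue vertex with all neighbours blue
-- sees every vertex blue already, so only B = V is a hopping forcing set.
-- Conversely, if u ≠ v are non-adjacent, then V ∖ {v} is a hopping forcing
-- set (u hops to v), so H(G) ≤ n − 1.
module Submission where

open import Defs
open import Data.Nat using (ℕ; _≤_)
open import Data.Nat.Properties using (≤-antisym)
open import Data.Bool using (true; false)
open import Data.Fin using (Fin)
open import Data.Fin.Properties using (_≟_)
open import Data.Fin.Subset using (Subset; _∈_; ⁅_⁆; _∪_; ∣_∣; ⊤; ∁) renaming (⊥ to ∅)
open import Data.Fin.Subset.Properties
  using (∈⊤; ∉⊥; x∈⁅x⁆; x≢y⇒x∉⁅y⁆; x∉p⇒x∈∁p; x∈p⇒x∉∁p; x∈∁p⇒x∉p; p∪∁p≡⊤; ∣⊤∣≡n; ∣p∣≤n; ∣p∣≡n⇒p≡⊤; p⊆q⇒∣p∣≤∣q∣)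
open import Data.Product using (_,_)
open import Data.Empty using (⊥-elim)
open import Function.Bundles using (_⇔_; mk⇔; Bijection)
open import Function.Construct.Identity using (⤖-id)
open import Relation.Nullary using (¬_; yes; no)
open import Relation.Binary.PropositionalEquality using (_≡_; _≢_; refl; sym; trans; subst)
open import Relation.Binary.Construct.Closure.ReflexiveTransitive using (ε; _◅_)

IsComplete : ∀ {n} → Graph n → Set
IsComplete {n} G = ∀ (u v : Fin n) → u ≢ v → adj G u v ≡ true

complete-isComplete : ∀ n → IsComplete (complete n)
complete-isComplete n u v u≢v with u ≟ v
... | yes u≡v = ⊥-elim (u≢v u≡v)
... | no _ = refl

isComplete-adj-unique : ∀ {n} (G H : Graph n) → IsComplete G → IsComplete H →
                        ∀ u v → adj G u v ≡ adj H u v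
isComplete-adj-unique G H G-complete H-complete u v with u ≟ v
... | yes refl = trans (adj-irrefl G u) (sym (adj-irrefl H u))
... | no u≢v = trans (G-complete u v u≢v) (sym (H-complete u v u≢v))

≅-isComplete : ∀ {n m} (G : Graph n) (H : Graph m) → G ≅ H → IsComplete H → IsComplete G
≅-isComplete _ _ (f , preserves) H-complete u v u≢v =
  trans (preserves u v) (H-complete _ _ λ fu≡fv → u≢v (Bijection.injective f fu≡fv))

isComplete⇒≅complete : ∀ {n} (G : Graph n) → IsComplete G → G ≅ complete n
isComplete⇒≅complete {n} G G-complete =
  ⤖-id (Fin n) , isComplete-adj-unique G (complete n) G-complete (complete-isComplete n)

covers⇒n≤∣p∣ : ∀ {n} {p : Subset n} → (∀ x → x ∈ p) → n ≤ ∣ p ∣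
covers⇒n≤∣p∣ {n} {p} covers = subst (_≤ ∣ p ∣) (∣⊤∣≡n n) (p⊆q⇒∣p∣≤∣q∣ {p = ⊤} (λ {x} _ → covers x))

n≤∣p∣⇒p≡⊤ : ∀ {n} {p : Subset n} → n ≤ ∣ p ∣ → p ≡ ⊤
n≤∣p∣⇒p≡⊤ {p = p} n≤∣p∣ = ∣p∣≡n⇒p≡⊤ (≤-antisym (∣p∣≤n p) n≤∣p∣)

⊤-isHoppingForcingSet : ∀ {n} (G : Graph n) → IsHoppingForcingSet G ⊤
⊤-isHoppingForcingSet G = ∅ , ⊤ , ε , λ _ → ∈⊤

∁⁅v⁆-isHoppingForcingSet : ∀ {n} (G : Graph n) (u v : Fin n) → u ≢ v → adj G u v ≡ false →
                           IsHoppingForcingSet G (∁ ⁅ v ⁆)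
∁⁅v⁆-isHoppingForcingSet G u v u≢v uv-nonadjacent =
  _ , _ , force u v (≢v⇒∈∁⁅v⁆ u≢v) ∉⊥ (x∈p⇒x∉∁p (x∈⁅x⁆ v)) neighbours-blue ◅ ε , everything-blue
  where
  ≢v⇒∈∁⁅v⁆ : ∀ {x} → x ≢ v → x ∈ ∁ ⁅ v ⁆
  ≢v⇒∈∁⁅v⁆ x≢v = x∉p⇒x∈∁p (x≢y⇒x∉⁅y⁆ x≢v)

  neighbours-blue : ∀ x → adj G u x ≡ true → x ∈ ∁ ⁅ v ⁆
  neighbours-blue x ux-adjacent with x ≟ v
  ... | yes refl with trans (sym uv-nonadjacent) ux-adjacent
  ...   | ()
  neighbours-blue x _ | no x≢v = ≢v⇒∈∁⁅v⁆ x≢v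

  everything-blue : ∀ x → x ∈ ⁅ v ⁆ ∪ ∁ ⁅ v ⁆
  everything-blue x = subst (x ∈_) (sym (p∪∁p≡⊤ ⁅ v ⁆)) ∈⊤

isComplete⇒noHopStep : ∀ {n} {G : Graph n} → IsComplete G → ∀ {s s'} → ¬ HopStep G s s'
isComplete⇒noHopStep G-complete (force v w v-blue _ w-white neighbours-blue) with v ≟ w
... | yes refl = w-white v-blue
... | no v≢w = w-white (neighbours-blue w (G-complete v w v≢w))

isComplete⇒forcingSet-covers : ∀ {n} {G : Graph n} {B : Subset n} → IsComplete G →
                               IsHoppingForcingSet G B → ∀ x → x ∈ B
isComplete⇒forcingSet-covers _ (_ , _ , ε , covers) = covers
isComplete⇒forcingSet-covers G-complete (_ , _ , step ◅ _ , _) =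
  ⊥-elim (isComplete⇒noHopStep G-complete step)

isComplete⇒H≡n : ∀ {n} (G : Graph n) → IsComplete G → HoppingForcingNumber G n
isComplete⇒H≡n {n} G G-complete =
  (⊤ , ⊤-isHoppingForcingSet G , ∣⊤∣≡n n) ,
  λ B B-forcing → covers⇒n≤∣p∣ (isComplete⇒forcingSet-covers G-complete B-forcing)

H≡n⇒isComplete : ∀ {n} (G : Graph n) → HoppingForcingNumber G n → IsComplete G
H≡n⇒isComplete G (_ , minimal) u v u≢v with adj G u v in uv-adjacency
... | true = refl
... | false = ⊥-elim (x∈∁p⇒x∉p v∈∁⁅v⁆ (x∈⁅x⁆ v))
  where
  ∁⁅v⁆≡⊤ : ∁ ⁅ v ⁆ ≡ ⊤
  ∁⁅v⁆≡⊤ = n≤∣p∣⇒p≡⊤ (minimal _ (∁⁅v⁆-isHoppingForcingSet G u v u≢v uv-adjacency))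

  v∈∁⁅v⁆ : v ∈ ∁ ⁅ v ⁆
  v∈∁⁅v⁆ = subst (v ∈_) (sym ∁⁅v⁆≡⊤) (∈⊤ {x = v})

proposition2p2 : (n : ℕ) (G : Graph n) → HoppingForcingNumber G n ⇔ (G ≅ complete n)
proposition2p2 n G = mk⇔
  (λ H≡n → isComplete⇒≅complete G (H≡n⇒isComplete G H≡n))
  (λ G≅Kn → isComplete⇒H≡n G (≅-isComplete G (complete n) G≅Kn (complete-isComplete n)))
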